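{- Let $G$ be a finite bipartite graph of order at least $3$. Then $\chi_{rlid}(G)\leq 3$.
   Context: For a vertex $x$, $N[x]$ is its closed neighborhood. An $rlid$-coloring of a graph $H$ is a map $c:V(H)\to\mathbb{N}$ (not necessarily proper) such that for every pair of adjacent vertices $u,v$ with $N[u]\neq N[v]$ we have $c(N[u])\neq c(N[v])$, where $c(X)=\{c(x):x\in X\}$; $\chi_{rlid}(H)$ is the minimum number of colors in an $rlid$-coloring of $H$. -}

module Defs where

open import Data.Nat using (ℕ; _≤_)
open import Data.Fin using (Fin)
open import Data.Bool using (Bool)
open import Data.Product using (Σ; ∃; _×_; _,_)
open import Data.Sum using (_⊎_)
open import Relation.Binary.PropositionalEquality using (_≡_; _≢_)
open import Relation.Nullary using (¬_; Dec)
open import Level using (0ℓ)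
open import Function.Bundles using (_⇔_)

record Graph (n : ℕ) : Set₁ where
  field
    Adj     : Fin n → Fin n → Set
    adj?    : ∀ u v → Dec (Adj u v)
    sym     : ∀ {u v} → Adj u v → Adj v u
    irrefl  : ∀ {u} → ¬ Adj u u

open Graph public

Bipartite : ∀ {n} → Graph n → Set
Bipartite {n} G = Σ (Fin n → Bool) λ side → ∀ u v → Adj G u v → side u ≢ side v

_∈N[_] : ∀ {n} {G : Graph n} → Fin n → Fin n → Set
_∈N[_] {G = G} w x = (w ≡ x) ⊎ Adj G x w

SameClosedNbhd : ∀ {n} → Graph n → Fin n → Fin n → Set
SameClosedNbhd G u v = ∀ w → (_∈N[_] {G = G} w u) ⇔ (_∈N[_] {G = G} w v)

ColourIn : ∀ {n} {C : Set} → Graph n → (Fin n → C) → Fin n → C → Set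
ColourIn {n} G c x k = Σ (Fin n) λ w → (_∈N[_] {G = G} w x) × (c w ≡ k)

SameColourSet : ∀ {n} {C : Set} → Graph n → (Fin n → C) → Fin n → Fin n → Set
SameColourSet {C = C} G c u v = ∀ (k : C) → ColourIn G c u k ⇔ ColourIn G c v k

IsRlidColouring : ∀ {n} {C : Set} → Graph n → (Fin n → C) → Set
IsRlidColouring G c =
  ∀ u v → Adj G u v → ¬ SameClosedNbhd G u v → ¬ SameColourSet G c u v

χrlid≤ : ∀ {n} → Graph n → ℕ → Set
χrlid≤ {n} G k = Σ (Fin n → Fin k) λ c → IsRlidColouring G c

-- Root each component of G at a vertex that is not the centre of a star K₁,ₘ (m ≥ 2) and take
-- breadth-first layers; as G is bipartite, every edge joins consecutive layers. Colour layer
-- 4i with 0 and layer 4i+2 with 2; in layers 4i+1 and 4i+3 a vertex gets colour 1 if it has a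
-- neighbour in the next layer, and 0 resp. 2 otherwise. For an edge uv with v one layer below u,
-- either the colour of a child of v or the colour of the parent of u lies in exactly one of
-- c(N[u]) and c(N[v]). The one exception, a root whose neighbours are all leaves, has
-- N[u] = N[v] by the choice of roots.
-- Building the layering needs decidable connectivity, which is only available classically; that
-- is enough, since χrlid(G) ≤ 3 is decidable by exhaustive search over colourings.

module Submission where

open import Defs hiding (sym)
open import Data.Bool using (Bool; true; false; not)
open import Data.Bool.Properties using (¬-not)
open import Data.Empty using (⊥-elim)
open import Data.Fin using (Fin; zero; suc; toℕ; finToFun; funToFin; #_)
open import Data.Fin.Properties using (any?; all?; _≟_; finToFun-funToFin; toℕ-injective)
open import Data.Nat using (ℕ; zero; suc; _≤_; z≤n; s≤s)
import Data.Nat.Properties as ℕ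
open import Data.Nat.GeneralisedArithmetic using (fold)
open import Data.Product using (Σ; ∃; _×_; _,_; proj₁; proj₂)
open import Data.Sum using (_⊎_; inj₁; inj₂)
open import Function.Base using (_∘_)
open import Function.Bundles using (_⇔_; mk⇔; Equivalence)
open import Function.Properties.Equivalence using () renaming (sym to ⇔-sym)
open import Relation.Binary.Construct.Closure.ReflexiveTransitive
  using (Star; ε; _◅_; _◅◅_; reverse; return)
open import Relation.Binary.Definitions using (tri<; tri≈; tri>)
open import Relation.Binary.PropositionalEquality
  using (_≡_; _≢_; _≗_; refl; sym; trans; cong; cong₂; subst; subst₂; module ≡-Reasoning)
open import Relation.Nullary using (¬_; Dec; yes; no; does)
open import Relation.Nullary.Decidable
  using (map′; _×-dec_; _⊎-dec_; _→-dec_; ¬?; dec-true; dec-false; decidable-stable;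
         toWitnessFalse; False; ¬¬-excluded-middle)
open import Relation.Nullary.Negation using (¬¬-map)

least-witness : {P : ℕ → Set} → (∀ j → Dec (P j)) → ∀ {m} → P m →
                Σ ℕ λ k → P k × (∀ {j} → P j → k ≤ j)
least-witness P? {zero} p = 0 , p , λ _ → z≤n
least-witness {P} P? {suc m} p with P? 0
... | yes p₀ = 0 , p₀ , λ _ → z≤n
... | no ¬p₀ with least-witness {P ∘ suc} (P? ∘ suc) {m} p
...   | k , pk , least = suc k , pk , λ { {zero} p₀ → ⊥-elim (¬p₀ p₀) ; {suc j} pj → s≤s (least pj) }

¬¬-∀-Fin : ∀ {n} {P : Fin n → Set} → (∀ i → ¬ ¬ P i) → ¬ ¬ (∀ i → P i)
¬¬-∀-Fin {zero} _ ¬∀ = ¬∀ λ ()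
¬¬-∀-Fin {suc n} {P} ¬¬P ¬∀ =
  ¬¬P zero λ p₀ → ¬¬-∀-Fin {P = P ∘ suc} (¬¬P ∘ suc) λ ps → ¬∀ λ { zero → p₀ ; (suc i) → ps i }

_⇔?_ : {A B : Set} → Dec A → Dec B → Dec (A ⇔ B)
a? ⇔? b? = map′ (λ (f , g) → mk⇔ f g) (λ e → Equivalence.to e , Equivalence.from e)
                ((a? →-dec b?) ×-dec (b? →-dec a?))

module _ {n} (G : Graph n) where

  ∈N[]? : ∀ w x → Dec (_∈N[_] {G = G} w x)
  ∈N[]? w x = (w ≟ x) ⊎-dec adj? G x w

  sameClosedNbhd? : ∀ u v → Dec (SameClosedNbhd G u v)
  sameClosedNbhd? u v = all? λ w → ∈N[]? w u ⇔? ∈N[]? w v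

  module _ {k} (c : Fin n → Fin k) where

    colourIn? : ∀ x j → Dec (ColourIn G c x j)
    colourIn? x j = any? λ w → ∈N[]? w x ×-dec (c w ≟ j)

    sameColourSet? : ∀ u v → Dec (SameColourSet G c u v)
    sameColourSet? u v = all? λ j → colourIn? u j ⇔? colourIn? v j

    isRlidColouring? : Dec (IsRlidColouring G c)
    isRlidColouring? = all? λ u → all? λ v →
      adj? G u v →-dec (¬? (sameClosedNbhd? u v) →-dec ¬? (sameColourSet? u v))

  colourIn-≗ : ∀ {k} {c c′ : Fin n → Fin k} → c ≗ c′ → ∀ {x j} → ColourIn G c x j → ColourIn G c′ x j
  colourIn-≗ c≗c′ (w , w∈N[x] , refl) = w , w∈N[x] , sym (c≗c′ w)

  isRlidColouring-≗ : ∀ {k} {c c′ : Fin n → Fin k} → c ≗ c′ → IsRlidColouring G c → IsRlidColouring G c′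
  isRlidColouring-≗ c≗c′ rlid u v uv N[u]≢N[v] same = rlid u v uv N[u]≢N[v] λ j → mk⇔
    (colourIn-≗ (sym ∘ c≗c′) ∘ Equivalence.to (same j) ∘ colourIn-≗ c≗c′)
    (colourIn-≗ (sym ∘ c≗c′) ∘ Equivalence.from (same j) ∘ colourIn-≗ c≗c′)

  χrlid≤? : ∀ k → Dec (χrlid≤ G k)
  χrlid≤? k = map′ (λ (i , rlid) → finToFun i , rlid)
                   (λ (c , rlid) → funToFin c , isRlidColouring-≗ (sym ∘ finToFun-funToFin c) rlid)
                   (any? λ i → isRlidColouring? (finToFun i))

module _ {n} (G : Graph n) where

  IsStarCentre : Fin n → Set
  IsStarCentre x = (Σ (Fin n) λ y → Σ (Fin n) λ z → Adj G x y × Adj G x z × y ≢ z)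
                 × (∀ y w → Adj G x y → Adj G y w → w ≡ x)

  isStarCentre? : ∀ x → Dec (IsStarCentre x)
  isStarCentre? x =
    (any? λ y → any? λ z → adj? G x y ×-dec adj? G x z ×-dec ¬? (y ≟ z))
    ×-dec (all? λ y → all? λ w → adj? G x y →-dec (adj? G y w →-dec (w ≟ x)))

  -- The last field is all that is used of having one root per component.
  record Layering : Set where
    field
      depth : Fin n → ℕ
      edge-between-layers : ∀ {u v} → Adj G u v →
                            depth v ≡ suc (depth u) ⊎ depth u ≡ suc (depth v)
      parent : ∀ {x k} → depth x ≡ suc k → Σ (Fin n) λ y → Adj G y x × depth y ≡ k
      root-not-star-centre : ∀ {x} → depth x ≡ 0 → ¬ IsStarCentre x
      roots-with-common-neighbour-equal : ∀ {u y w} → depth u ≡ 0 → depth w ≡ 0 →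
                                          Adj G u y → Adj G y w → u ≡ w

  Connected : Fin n → Fin n → Set
  Connected = Star (Adj G)

  data Walk (a : Fin n) : Fin n → ℕ → Set where
    []  : Walk a a 0
    _▷_ : ∀ {b c m} → Walk a b m → Adj G b c → Walk a c (suc m)

  _◁_ : ∀ {a b c m} → Adj G a b → Walk b c m → Walk a c (suc m)
  ab ◁ [] = [] ▷ ab
  ab ◁ (w ▷ e) = (ab ◁ w) ▷ e

  walk⇒connected : ∀ {a b m} → Walk a b m → Connected a b
  walk⇒connected [] = ε
  walk⇒connected (w ▷ e) = walk⇒connected w ◅◅ return e

  connected⇒walk : ∀ {a b} → Connected a b → ∃ (Walk a b)
  connected⇒walk ε = 0 , []
  connected⇒walk (e ◅ s) with connected⇒walk s
  ... | m , w = suc m , e ◁ w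

  unsnoc : ∀ {a c m} → Walk a c (suc m) → Σ (Fin n) λ b → Walk a b m × Adj G b c
  unsnoc (w ▷ e) = _ , w , e

  walk-length-zero : ∀ {a b} → Walk a b 0 → a ≡ b
  walk-length-zero [] = refl

  walk? : ∀ a c m → Dec (Walk a c m)
  walk? a c zero with a ≟ c
  ... | yes refl = yes []
  ... | no a≢c = no λ { [] → a≢c refl }
  walk? a c (suc m) = map′ (λ (b , w , e) → w ▷ e) unsnoc
                           (any? λ b → walk? a b m ×-dec adj? G b c)

  side-along-walk : ∀ (side : Fin n → Bool) → (∀ u v → Adj G u v → side u ≢ side v) →
                    ∀ {a b m} → Walk a b m → side b ≡ fold (side a) not m
  side-along-walk side bip [] = refl
  side-along-walk side bip (w ▷ e) =
    trans (¬-not (bip _ _ e ∘ sym)) (cong not (side-along-walk side bip w))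

data Phase : Set where
  φ₀ φ₁ φ₂ φ₃ : Phase

next prev : Phase → Phase
next φ₀ = φ₁
next φ₁ = φ₂
next φ₂ = φ₃
next φ₃ = φ₀
prev φ₀ = φ₃
prev φ₁ = φ₀
prev φ₂ = φ₁
prev φ₃ = φ₂

prev-next : ∀ p → prev (next p) ≡ p
prev-next φ₀ = refl
prev-next φ₁ = refl
prev-next φ₂ = refl
prev-next φ₃ = refl

phaseOf : ℕ → Phase
phaseOf zero = φ₀
phaseOf (suc m) = next (phaseOf m)

phaseOf≢φ₀⇒positive : ∀ m → phaseOf m ≢ φ₀ → ∃ λ k → m ≡ suc k
phaseOf≢φ₀⇒positive zero ≢φ₀ = ⊥-elim (≢φ₀ refl)
phaseOf≢φ₀⇒positive (suc k) _ = k , refl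

colour : Phase → (has-child : Bool) → Fin 3
colour φ₀ _ = # 0
colour φ₁ true = # 1
colour φ₁ false = # 0
colour φ₂ _ = # 2
colour φ₃ true = # 1
colour φ₃ false = # 2

-- Every colour in c(N[x]), for x in phase p with colour j: own, child's, or parent's (a parent
-- has a child).
NbhdColour : Phase → Fin 3 → Fin 3 → Set
NbhdColour p j k = k ≡ j ⊎ (k ≡ colour (next p) true ⊎ k ≡ colour (next p) false)
                         ⊎ k ≡ colour (prev p) true

nbhdColour? : ∀ p j k → Dec (NbhdColour p j k)
nbhdColour? p j k = (k ≟ j) ⊎-dec ((k ≟ colour (next p) true) ⊎-dec (k ≟ colour (next p) false))
                            ⊎-dec (k ≟ colour (prev p) true)

module LayeredColouring {n} {G : Graph n} (L : Layering G) where
  open Layering L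

  HasChild : Fin n → Set
  HasChild x = Σ (Fin n) λ w → Adj G x w × depth w ≡ suc (depth x)

  hasChild? : ∀ x → Dec (HasChild x)
  hasChild? x = any? λ w → adj? G x w ×-dec (depth w ℕ.≟ suc (depth x))

  phase : Fin n → Phase
  phase x = phaseOf (depth x)

  c : Fin n → Fin 3
  c x = colour (phase x) (does (hasChild? x))

  In : Fin n → Fin 3 → Set
  In = ColourIn G c

  phase-child : ∀ {x w p} → depth w ≡ suc (depth x) → phase x ≡ p → phase w ≡ next p
  phase-child w-child x-ph = trans (cong phaseOf w-child) (cong next x-ph)

  phase-parent : ∀ {x y p} → depth x ≡ suc (depth y) → phase x ≡ p → phase y ≡ prev p
  phase-parent {y = y} x-child x-ph =
    trans (sym (prev-next (phase y))) (cong prev (trans (cong phaseOf (sym x-child)) x-ph))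

  positive-depth : ∀ {x p} → phase x ≡ p → p ≢ φ₀ → ∃ λ k → depth x ≡ suc k
  positive-depth {x} x-ph p≢φ₀ = phaseOf≢φ₀⇒positive (depth x) (p≢φ₀ ∘ trans (sym x-ph))

  c-phase : ∀ {x p} → phase x ≡ p → c x ≡ colour p (does (hasChild? x))
  c-phase {x} x-ph = cong (λ q → colour q (does (hasChild? x))) x-ph

  c-with-child : ∀ {x p} → phase x ≡ p → HasChild x → c x ≡ colour p true
  c-with-child {x} {p} x-ph h = trans (c-phase x-ph) (cong (colour p) (dec-true (hasChild? x) h))

  c-without-child : ∀ {x p} → phase x ≡ p → ¬ HasChild x → c x ≡ colour p false
  c-without-child {x} {p} x-ph ¬h = trans (c-phase x-ph) (cong (colour p) (dec-false (hasChild? x) ¬h))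

  c-cases : ∀ {x p} → phase x ≡ p → c x ≡ colour p true ⊎ c x ≡ colour p false
  c-cases {x} {p} x-ph = by-child (hasChild? x)
    where
      by-child : Dec (HasChild x) → c x ≡ colour p true ⊎ c x ≡ colour p false
      by-child (yes h) = inj₁ (c-with-child x-ph h)
      by-child (no ¬h) = inj₂ (c-without-child x-ph ¬h)

  in⇒nbhdColour : ∀ {x k} → In x k → NbhdColour (phase x) (c x) k
  in⇒nbhdColour (_ , inj₁ refl , refl) = inj₁ refl
  in⇒nbhdColour {x} (w , inj₂ xw , refl) with edge-between-layers xw
  ... | inj₁ w-child = inj₂ (inj₁ (c-cases (phase-child w-child refl)))
  ... | inj₂ x-child = inj₂ (inj₂ (c-with-child (phase-parent x-child refl) (x , Graph.sym G xw , x-child)))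

  absent : ∀ {x p j k} → phase x ≡ p → c x ≡ j → False (nbhdColour? p j k) → ¬ In x k
  absent {p = p} {j} {k} x-ph cx≡j impossible i =
    toWitnessFalse {a? = nbhdColour? p j k} impossible
      (subst₂ (λ q l → NbhdColour q l k) x-ph cx≡j (in⇒nbhdColour i))

  colour-in-via : ∀ {x w k} → Adj G x w → c w ≡ k → In x k
  colour-in-via {w = w} xw cw≡k = w , inj₂ xw , cw≡k

  parent-colour-in : ∀ {x p k} → phase x ≡ p → depth x ≡ suc k → In x (colour (prev p) true)
  parent-colour-in {x} x-ph x-child with parent x-child
  ... | y , yx , refl = colour-in-via (Graph.sym G yx) (c-with-child (phase-parent x-child x-ph) (x , yx , x-child))

  root-neighbour-child : ∀ {u y} → depth u ≡ 0 → Adj G u y → depth y ≡ suc (depth u)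
  root-neighbour-child u-root uy with edge-between-layers uy
  ... | inj₁ y-child = y-child
  ... | inj₂ u-child = ⊥-elim (ℕ.0≢1+n (trans (sym u-root) u-child))

  -- A root all of whose neighbours are childless has only leaves as neighbours; as it is not a
  -- star centre, it has a single neighbour v, and then N[u] = {u, v} = N[v].
  root-same-closed-nbhd : ∀ {u v} → depth u ≡ 0 → Adj G u v →
                          ¬ (Σ (Fin n) λ y → Adj G u y × HasChild y) → SameClosedNbhd G u v
  root-same-closed-nbhd {u} {v} u-root uv no-grandchild w = mk⇔ to from
    where
      back-to-u : ∀ {y z} → Adj G u y → Adj G y z → z ≡ u
      back-to-u {y} {z} uy yz with edge-between-layers yz
      ... | inj₁ z-child = ⊥-elim (no-grandchild (y , uy , z , yz , z-child))
      ... | inj₂ y-child = sym (roots-with-common-neighbour-equal u-root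
              (ℕ.suc-injective (trans (sym y-child) (trans (root-neighbour-child u-root uy) (cong suc u-root))))
              uy yz)

      only-v : ∀ {y} → Adj G u y → y ≡ v
      only-v {y} uy with y ≟ v
      ... | yes y≡v = y≡v
      ... | no y≢v = ⊥-elim (root-not-star-centre u-root ((y , v , uy , uv , y≢v) , λ _ _ → back-to-u))

      to : _∈N[_] {G = G} w u → _∈N[_] {G = G} w v
      to (inj₁ refl) = inj₂ (Graph.sym G uv)
      to (inj₂ uw) = inj₁ (only-v uw)

      from : _∈N[_] {G = G} w v → _∈N[_] {G = G} w u
      from (inj₁ refl) = inj₂ uv
      from (inj₂ vw) = inj₁ (back-to-u uv vw)

  colour₁-at-phase₀ : ∀ {u v} → phase u ≡ φ₀ → Adj G u v → ¬ SameClosedNbhd G u v → In u (# 1)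
  colour₁-at-phase₀ {u} u-ph uv N[u]≢N[v] = by-depth (depth u) refl
    where
      by-depth : ∀ m → depth u ≡ m → In u (# 1)
      by-depth (suc k) u-child = parent-colour-in u-ph u-child
      by-depth zero u-root with any? (λ y → adj? G u y ×-dec hasChild? y)
      ... | yes (y , uy , y-has-child) =
        colour-in-via uy (c-with-child (phase-child (root-neighbour-child u-root uy) u-ph) y-has-child)
      ... | no no-grandchild = ⊥-elim (N[u]≢N[v] (root-same-closed-nbhd u-root uv no-grandchild))

  Separates : Fin n → Fin n → Fin 3 → Set
  Separates u v k = (In u k × ¬ In v k) ⊎ (¬ In u k × In v k)

  -- In phases 1 and 3 the colour of u's parent separates. In phases 0 and 2 the colour of a child
  -- of v does, and if v is childless colour 1 does, found at u's parent or, at a root, at a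
  -- neighbour of u that has a child.
  separating-colour : ∀ {u v} → Adj G u v → depth v ≡ suc (depth u) → ¬ SameClosedNbhd G u v →
                      ∃ (Separates u v)
  separating-colour {u} {v} uv v-child N[u]≢N[v] with phase u in u-ph
  ... | φ₀ with hasChild? v
  ...   | yes (w , vw , w-child) =
          # 2 , inj₂ (absent u-ph (c-phase u-ph) _ ,
                      colour-in-via vw (c-phase (phase-child w-child (phase-child v-child u-ph))))
  ...   | no ¬h =
          # 1 , inj₁ (colour₁-at-phase₀ u-ph uv N[u]≢N[v] ,
                      absent (phase-child v-child u-ph) (c-without-child (phase-child v-child u-ph) ¬h) _)
  separating-colour {u} {v} uv v-child _ | φ₁ =
    # 0 , inj₁ (parent-colour-in u-ph (proj₂ (positive-depth u-ph λ ())) ,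
                absent (phase-child v-child u-ph) (c-phase (phase-child v-child u-ph)) _)
  separating-colour {u} {v} uv v-child _ | φ₂ with hasChild? v
  ...   | yes (w , vw , w-child) =
          # 0 , inj₂ (absent u-ph (c-phase u-ph) _ ,
                      colour-in-via vw (c-phase (phase-child w-child (phase-child v-child u-ph))))
  ...   | no ¬h =
          # 1 , inj₁ (parent-colour-in u-ph (proj₂ (positive-depth u-ph λ ())) ,
                      absent (phase-child v-child u-ph) (c-without-child (phase-child v-child u-ph) ¬h) _)
  separating-colour {u} {v} uv v-child _ | φ₃ =
    # 2 , inj₁ (parent-colour-in u-ph (proj₂ (positive-depth u-ph λ ())) ,
                absent (phase-child v-child u-ph) (c-phase (phase-child v-child u-ph)) _)

  separates⇒different : ∀ {u v} → ∃ (Separates u v) → ¬ SameColourSet G c u v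
  separates⇒different (k , inj₁ (in-u , ∉v)) same = ∉v (Equivalence.to (same k) in-u)
  separates⇒different (k , inj₂ (∉u , in-v)) same = ∉u (Equivalence.from (same k) in-v)

  isRlidColouring : IsRlidColouring G c
  isRlidColouring u v uv N[u]≢N[v] with edge-between-layers uv
  ... | inj₁ v-child = separates⇒different (separating-colour uv v-child N[u]≢N[v])
  ... | inj₂ u-child = separates⇒different
          (separating-colour (Graph.sym G uv) u-child (N[u]≢N[v] ∘ λ same w → ⇔-sym (same w)))
        ∘ λ same k → ⇔-sym (same k)

layered⇒χrlid≤3 : ∀ {n} {G : Graph n} → Layering G → χrlid≤ G 3
layered⇒χrlid≤3 L = LayeredColouring.c L , LayeredColouring.isRlidColouring L

module BipartiteLayering {n} (G : Graph n) (side : Fin n → Bool)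
         (bip : ∀ u v → Adj G u v → side u ≢ side v)
         (connected? : ∀ a b → Dec (Connected G a b)) where

  non-centre-nearby : ∀ x → Σ (Fin n) λ g → ¬ IsStarCentre G g × Connected G g x
  non-centre-nearby x with isStarCentre? G x
  ... | no ¬centre = x , ¬centre , ε
  ... | yes ((y , _ , xy , _) , leaves) = y , y-not-centre , return (Graph.sym G xy)
    where
      y-not-centre : ¬ IsStarCentre G y
      y-not-centre ((p , q , yp , yq , p≢q) , _) = p≢q (trans (leaves y p xy yp) (sym (leaves y q xy yq)))

  IsRoot : Fin n → Set
  IsRoot r = ¬ IsStarCentre G r × (∀ y → ¬ IsStarCentre G y → Connected G y r → toℕ r ≤ toℕ y)

  isRoot? : ∀ r → Dec (IsRoot r)
  isRoot? r = ¬? (isStarCentre? G r) ×-dec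
              all? λ y → ¬? (isStarCentre? G y) →-dec (connected? y r →-dec (toℕ r ℕ.≤? toℕ y))

  connected-roots-equal : ∀ {a b} → IsRoot a → IsRoot b → Connected G a b → a ≡ b
  connected-roots-equal (a-ok , a-least) (b-ok , b-least) ab =
    toℕ-injective (ℕ.≤-antisym (a-least _ b-ok (reverse (Graph.sym G) ab)) (b-least _ a-ok ab))

  RootCandidate : Fin n → ℕ → Set
  RootCandidate x j = Σ (Fin n) λ r → toℕ r ≡ j × ¬ IsStarCentre G r × Connected G r x

  root-of : ∀ x → Σ (Fin n) λ r → IsRoot r × Connected G r x
  root-of x with non-centre-nearby x
  ... | g , g-ok , gx with least-witness {RootCandidate x}
                             (λ j → any? λ r → (toℕ r ℕ.≟ j) ×-dec ¬? (isStarCentre? G r) ×-dec connected? r x)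
                             (g , refl , g-ok , gx)
  ...   | _ , (r , refl , r-ok , rx) , least = r , (r-ok , λ y y-ok yr → least (y , refl , y-ok , yr ◅◅ rx)) , rx

  RootWalk : ℕ → Fin n → Set
  RootWalk j x = Σ (Fin n) λ r → IsRoot r × Walk G r x j

  -- Opaque so that depth does not unfold into the search during type checking.
  opaque
    shortest-root-walk : ∀ x → Σ ℕ λ k → RootWalk k x × (∀ {j} → RootWalk j x → k ≤ j)
    shortest-root-walk x with root-of x
    ... | r , r-root , rx with connected⇒walk G rx
    ...   | _ , w = least-witness (λ j → any? λ r → isRoot? r ×-dec walk? G r x j) (r , r-root , w)

  depth : Fin n → ℕ
  depth x = proj₁ (shortest-root-walk x)

  depth-walk : ∀ x → RootWalk (depth x) x
  depth-walk x = proj₁ (proj₂ (shortest-root-walk x))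

  depth-minimal : ∀ {j x} → RootWalk j x → depth x ≤ j
  depth-minimal {x = x} = proj₂ (proj₂ (shortest-root-walk x))

  depth-step : ∀ {u v} → Adj G u v → depth v ≤ suc (depth u)
  depth-step {u} uv with depth-walk u
  ... | r , r-root , ru = depth-minimal (r , r-root , ru ▷ uv)

  adjacent-depths-differ : ∀ {u v} → Adj G u v → depth u ≢ depth v
  adjacent-depths-differ {u} {v} uv du≡dv with depth-walk u | depth-walk v
  ... | r , r-root , ru | s , s-root , sv = bip u v uv (begin
      side u                    ≡⟨ side-along-walk G side bip ru ⟩
      fold (side r) not (depth u) ≡⟨ cong₂ (λ t m → fold (side t) not m) r≡s du≡dv ⟩
      fold (side s) not (depth v) ≡⟨ sym (side-along-walk G side bip sv) ⟩
      side v                    ∎)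
    where
      open ≡-Reasoning
      r≡s : r ≡ s
      r≡s = connected-roots-equal r-root s-root
              (walk⇒connected G (ru ▷ uv) ◅◅ reverse (Graph.sym G) (walk⇒connected G sv))

  edge-between-layers : ∀ {u v} → Adj G u v → depth v ≡ suc (depth u) ⊎ depth u ≡ suc (depth v)
  edge-between-layers {u} {v} uv with ℕ.<-cmp (depth u) (depth v)
  ... | tri< du<dv _ _ = inj₁ (ℕ.≤-antisym (depth-step uv) du<dv)
  ... | tri≈ _ du≡dv _ = ⊥-elim (adjacent-depths-differ uv du≡dv)
  ... | tri> _ _ dv<du = inj₂ (ℕ.≤-antisym (depth-step (Graph.sym G uv)) dv<du)

  parent : ∀ {x k} → depth x ≡ suc k → Σ (Fin n) λ y → Adj G y x × depth y ≡ k
  parent {x} {k} x-depth with depth-walk x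
  ... | r , r-root , rx with unsnoc G (subst (Walk G r x) x-depth rx)
  ...   | y , ry , yx = y , yx , ℕ.≤-antisym (depth-minimal (r , r-root , ry))
                                   (ℕ.≤-pred (subst (_≤ suc (depth y)) x-depth (depth-step yx)))

  depth-zero⇒root : ∀ {x} → depth x ≡ 0 → IsRoot x
  depth-zero⇒root {x} x-depth with depth-walk x
  ... | r , r-root , rx = subst IsRoot (walk-length-zero G (subst (Walk G r x) x-depth rx)) r-root

  layering : Layering G
  layering = record
    { depth = depth
    ; edge-between-layers = edge-between-layers
    ; parent = parent
    ; root-not-star-centre = λ x-depth → proj₁ (depth-zero⇒root x-depth)
    ; roots-with-common-neighbour-equal = λ u-depth w-depth uy yw →
        connected-roots-equal (depth-zero⇒root u-depth) (depth-zero⇒root w-depth) (uy ◅ yw ◅ ε)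
    }

bipartite⇒¬¬layering : ∀ {n} (G : Graph n) → Bipartite G → ¬ ¬ Layering G
bipartite⇒¬¬layering G (side , bip) =
  ¬¬-map (BipartiteLayering.layering G side bip)
         (¬¬-∀-Fin λ a → ¬¬-∀-Fin λ b → ¬¬-excluded-middle)

mainTheorem5 : (n : ℕ) → 3 ≤ n → (G : Graph n) → Bipartite G → χrlid≤ G 3
mainTheorem5 n _ G bipartite =
  decidable-stable (χrlid≤? G 3) (¬¬-map layered⇒χrlid≤3 (bipartite⇒¬¬layering G bipartite))
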